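{- The subalgebra $\mathcal B^1$ of $\mathcal H$ generated by $\mathcal G^1\cup\{1\}$ is a Hopf algebra, i.e. $\Delta(\mathcal B^1)\subseteq\mathcal B^1\otimes\mathcal B^1$.
   Context: An ordered forest of degree $n\ge0$ is a planar rooted forest (left-to-right sequence of rooted trees, children of each vertex linearly ordered left to right) with $n$ vertices together with a bijection from its vertex set to $\{1,\dots,n\}$ (labels); edges point towards roots; $1$ is the empty forest, $\bullet_1$ the one-vertex tree, $|F|$ the degree. The product $FG$ is concatenation, labels of $F$ kept, labels of $G$ increased by $|F|$. A subset $\boldsymbol v$ of vertices of $F$ is an admissible cut if no two distinct elements are joined by a directed path; $Lea_{\boldsymbol v}(F)$ is the subforest of vertices whose path to the root meets $\boldsymbol v$, $Roo_{\boldsymbol v}(F)$ the subforest of the other vertices, both with inherited planar structure and labels standardized onto $\{1,\dots,k\}$ increasingly. $\mathcal H$ is the $\mathbb K$-vector space with basis the ordered forests, with this product and coproduct $\Delta(F)=\sum_{\boldsymbol v}Lea_{\boldsymbol v}(F)\otimes Roo_{\boldsymbol v}(F)$ over all admissible cuts; it is a graded Hopf algebra. For $n\ge1$ and $\underline\varepsilon=(\varepsilon_1,\dots,\varepsilon_n)\in\{+,-\}^n$ define sets $\mathcal G^{(\underline\varepsilon)}$ of ordered forests of degree $n$ recursively: $\mathcal G^{(\varepsilon_1)}=\{\bullet_1\}$; for $n\ge2$, let $F'$ range over $\mathcal G^{(\varepsilon_1,\dots,\varepsilon_{n-1})}$ with trees $T_1,\dots,T_m$ from left to right; all vertices of $F'$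 keep their labels and a new vertex labelled $n$ is added. If $\varepsilon_n=-$: add a new root whose children are the roots of $T_1,\dots,T_m$ in order. If $\varepsilon_n=+$: either add the new vertex as a one-vertex tree at the right end, or, for some $1\le i\le m$, attach the new vertex as rightmost child of the root of $T_i$ and make the roots of $T_{i+1},\dots,T_m$ (in order) the children of the new vertex. $\mathcal G^1=\bigcup_{n\ge1,\ \varepsilon_n\in\{+,-\}}\mathcal G^{(+,\dots,+,\varepsilon_n)}$ (words of length $n$ whose first $n-1$ letters are $+$). -}

module Defs where

open import Level using (Level)
open import Data.Nat using (ℕ; zero; suc; _+_; _<?_)
open import Data.Nat.Properties using () renaming (_≟_ to _≟ℕ_)
open import Data.List using (List; []; _∷_; _++_; [_]; map; concatMap; concat; filter; length; replicate; foldr; _∷ʳ_)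
open import Data.List.Relation.Unary.All using (All)
open import Data.Product using (_×_; _,_; ∃; proj₁; proj₂)
open import Relation.Nullary using (Dec; yes; no; ¬_)
open import Relation.Binary.PropositionalEquality using (_≡_; refl)
open import Algebra.Bundles using (CommutativeRing)

-- Ordered forests: planar rooted forests whose vertices carry ℕ labels.
-- A forest of degree n is meant to carry the labels 1..n bijectively
-- (all forests arising below do).

data Tree : Set where
  node : ℕ → List Tree → Tree

Forest : Set
Forest = List Tree

𝟙 : Forest
𝟙 = []

•₁ : Forest
•₁ = node 1 [] ∷ []

mutual
  sizeT : Tree → ℕ
  sizeT (node _ ts) = suc (sizeF ts)

  sizeF : Forest → ℕ
  sizeF [] = 0
  sizeF (t ∷ ts) = sizeT t + sizeF ts

mutual
  labelsT : Tree → List ℕ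
  labelsT (node a ts) = a ∷ labelsF ts

  labelsF : Forest → List ℕ
  labelsF [] = []
  labelsF (t ∷ ts) = labelsT t ++ labelsF ts

mutual
  relabelT : (ℕ → ℕ) → Tree → Tree
  relabelT f (node a ts) = node (f a) (relabelF f ts)

  relabelF : (ℕ → ℕ) → Forest → Forest
  relabelF f [] = []
  relabelF f (t ∷ ts) = relabelT f t ∷ relabelF f ts

_·_ : Forest → Forest → Forest
F · G = F ++ relabelF (sizeF F +_) G

-- standardisation of (distinct) labels onto 1..k, increasingly
std : Forest → Forest
std F = relabelF (λ a → suc (length (filter (_<? a) (labelsF F)))) F

-- admissible cuts: each antichain v of vertices gives (Lea_v , Roo_v)
-- (unstandardised).  For a tree: either the root is in v, or v lies in
-- the subforest of children.
mutual
  cutsT : Tree → List (Forest × Forest)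
  cutsT (node a ts) =
    (node a ts ∷ [] , []) ∷ map (λ p → proj₁ p , node a (proj₂ p) ∷ []) (cutsF ts)

  cutsF : Forest → List (Forest × Forest)
  cutsF [] = ([] , []) ∷ []
  cutsF (t ∷ ts) =
    concatMap (λ p → map (λ q → (proj₁ p ++ proj₁ q) , (proj₂ p ++ proj₂ q)) (cutsF ts)) (cutsT t)

-- Δ(F) = Σ_v Lea_v(F) ⊗ Roo_v(F), as the list of its terms (one per cut)
Δterms : Forest → List (Forest × Forest)
Δterms F = map (λ p → std (proj₁ p) , std (proj₂ p)) (cutsF F)

mutual
  _≟T_ : (s t : Tree) → Dec (s ≡ t)
  node a xs ≟T node b ys with a ≟ℕ b | xs ≟F ys
  ... | yes refl | yes refl = yes refl
  ... | no p | _ = no λ { refl → p refl }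
  ... | yes _ | no q = no λ { refl → q refl }

  _≟F_ : (s t : Forest) → Dec (s ≡ t)
  [] ≟F [] = yes refl
  [] ≟F (_ ∷ _) = no λ ()
  (_ ∷ _) ≟F [] = no λ ()
  (x ∷ xs) ≟F (y ∷ ys) with x ≟T y | xs ≟F ys
  ... | yes refl | yes refl = yes refl
  ... | no p | _ = no λ { refl → p refl }
  ... | yes _ | no q = no λ { refl → q refl }

_≟FF_ : (s t : Forest × Forest) → Dec (s ≡ t)
(a , b) ≟FF (c , d) with a ≟F c | b ≟F d
... | yes refl | yes refl = yes refl
... | no p | _ = no λ { refl → p refl }
... | yes _ | no q = no λ { refl → q refl }

data Sign : Set where
  plus minus : Sign

-- InG w F  :  F ∈ G^(w).  The new vertex has label n = length w + 1.
data InG : List Sign → Forest → Set where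
  base : ∀ e → InG (e ∷ []) •₁
  addMinus : ∀ {w F} → InG w F →
    InG (w ∷ʳ minus) (node (suc (length w)) F ∷ [])
  addPlusRight : ∀ {w F} → InG w F →
    InG (w ∷ʳ plus) (F ∷ʳ node (suc (length w)) [])
  addPlusAttach : ∀ {w} ts₁ a cs ts₂ → InG w (ts₁ ++ node a cs ∷ ts₂) →
    InG (w ∷ʳ plus) (ts₁ ++ node a (cs ∷ʳ node (suc (length w)) ts₂) ∷ [])

-- G^1 = ⋃_{n ≥ 1, ε} G^(+,…,+,ε)  (n-1 plus signs, here k = n-1)
G¹ : Forest → Set
G¹ F = ∃ λ k → ∃ λ e → InG (replicate k plus ∷ʳ e) F

Mono : Forest → Set
Mono F = ∃ λ Fs → All G¹ Fs × F ≡ foldr _·_ 𝟙 Fs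

-- Linear algebra over K: elements of H (resp. H ⊗ H) are finite formal
-- K-linear combinations of forests (resp. pairs of forests), compared
-- coefficientwise.

module Linear {c ℓ : Level} (K : CommutativeRing c ℓ) where
  open CommutativeRing K renaming (_+_ to _+K_)

  IsField : Set (c Level.⊔ ℓ)
  IsField = (¬ (1# ≈ 0#)) × (∀ x → ¬ (x ≈ 0#) → ∃ λ y → x * y ≈ 1#)

  Lin : Set → Set c
  Lin X = List (Carrier × X)

  coeff : {X : Set} → ((s t : X) → Dec (s ≡ t)) → Lin X → X → Carrier
  coeff _≟_ [] x = 0#
  coeff _≟_ ((k , y) ∷ l) x with y ≟ x
  ... | yes _ = k +K coeff _≟_ l x
  ... | no _ = coeff _≟_ l x

  H : Set c
  H = Lin Forest

  H⊗H : Set c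
  H⊗H = Lin (Forest × Forest)

  _≈H_ : H → H → Set ℓ
  a ≈H b = ∀ F → coeff _≟F_ a F ≈ coeff _≟F_ b F

  _≈H⊗H_ : H⊗H → H⊗H → Set ℓ
  a ≈H⊗H b = ∀ p → coeff _≟FF_ a p ≈ coeff _≟FF_ b p

  _⊗_ : H → H → H⊗H
  a ⊗ b = concatMap (λ x → map (λ y → (proj₁ x * proj₁ y) , (proj₂ x , proj₂ y)) b) a

  Δ : H → H⊗H
  Δ a = concatMap (λ x → map (λ p → proj₁ x , p) (Δterms (proj₂ x))) a

  -- B^1 : the subalgebra generated by G^1 ∪ {1}, i.e. the span of all
  -- finite products of elements of G^1 ∪ {1}
  InB¹ : H → Set (c Level.⊔ ℓ)
  InB¹ a = ∃ λ (b : H) → All (λ x → Mono (proj₂ x)) b × a ≈H b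

  InB¹⊗B¹ : H⊗H → Set (c Level.⊔ ℓ)
  InB¹⊗B¹ t = ∃ λ (ps : List (H × H)) →
    All (λ p → InB¹ (proj₁ p) × InB¹ (proj₂ p)) ps ×
    t ≈H⊗H concat (map (λ p → proj₁ p ⊗ proj₂ p) ps)

-- A forest is obtained from •₁ by + steps alone exactly when it is a product of
-- plus trees, and by + steps followed by one − step exactly when it is a minus
-- tree; here a plus tree is a root labelled 1 above a product of minus trees and a
-- minus tree is a root carrying the largest label above a product of plus trees.
-- Standardisation turns the Lea and Roo parts of a cut of a product into the
-- products of the parts of cuts of the factors.  Cutting a plus tree strictly
-- below its root cuts the product of minus trees beneath it, and dually for minus
-- trees, so by mutual induction every Lea part is a product of elements of G¹ and
-- every Roo part of a product of plus (minus) trees is again one.  Hence Δ sends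
-- each monomial of B¹ to a sum of tensors of monomials, and Δ(B¹) ⊆ B¹ ⊗ B¹ follows
-- by linearity once Δ is shown to respect coefficientwise equality.

module Submission where

open import Level using (Level)
open import Algebra.Bundles using (CommutativeRing)
open import Data.Empty using (⊥-elim)
open import Data.List using (List; []; _∷_; _++_; [_]; map; concat; filter; length; foldr; replicate; _∷ʳ_)
open import Data.List.Properties
  using ( ++-assoc; ++-identityʳ; length-++; filter-++; filter-all; filter-none; filter-accept; filter-reject
        ; map-++; concat-++; foldr-++; ∷-injective; ∷ʳ-injectiveˡ; ∷ʳ-injectiveʳ)
open import Data.List.Membership.Propositional using (_∈_; find)
open import Data.List.Membership.Propositional.Properties using (∈-map⁻; ∈-concatMap⁻)
open import Data.List.Relation.Binary.Pointwise using (Pointwise; []; _∷_) renaming (++⁺ to Pointwise-++⁺)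
open import Data.List.Relation.Unary.Any using (here; there)
open import Data.List.Relation.Unary.All using (All; []; _∷_; tabulate) renaming (map to All-map)
open import Data.List.Relation.Unary.All.Properties using (++⁺; ++⁻ˡ; ++⁻ʳ; map⁺; replicate⁺)
open import Data.Nat using (ℕ; suc; _+_; _≤_; _<_; s≤s; z≤n; _<?_)
open import Data.Nat.Properties
  using ( +-assoc; +-comm; +-suc; +-identityʳ; ≤-refl; ≤-trans; <-irrefl; ≤-<-trans; <-asym; m≤m+n; m≤n+m
        ; m<m+n; n≤1+n; m≤n⇒m≤1+n; +-mono-≤; +-monoʳ-≤; +-monoʳ-<; +-cancelˡ-<)
open import Data.Nat.Tactic.RingSolver using (solve-∀)
open import Data.Product using (_×_; _,_; proj₁; proj₂; ∃; ∃₂)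
open import Data.Sum using (_⊎_; inj₁; inj₂)
open import Function using (_∘_; id)
open import Relation.Binary.Definitions using (DecidableEquality)
open import Relation.Binary.PropositionalEquality
  using (_≡_; refl; sym; trans; cong; cong₂; subst; subst₂; module ≡-Reasoning)
open import Relation.Nullary using (¬_; yes; no)
open ≡-Reasoning

open import Defs

variable
  x : ℕ
  f g : ℕ → ℕ
  t : Tree
  w v : List Sign
  A B D F M X Y l r : Forest
  P Q Q′ : Forest → Set

-- Relabelling

mutual
  relabelT-cong : ∀ t → All (λ x → f x ≡ g x) (labelsT t) → relabelT f t ≡ relabelT g t
  relabelT-cong (node a ts) (e ∷ es) = cong₂ node e (relabelF-cong ts es)

  relabelF-cong : ∀ F → All (λ x → f x ≡ g x) (labelsF F) → relabelF f F ≡ relabelF g F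
  relabelF-cong [] _ = refl
  relabelF-cong (t ∷ ts) es =
    cong₂ _∷_ (relabelT-cong t (++⁻ˡ (labelsT t) es)) (relabelF-cong ts (++⁻ʳ (labelsT t) es))

relabelF-ext : (∀ x → f x ≡ g x) → ∀ F → relabelF f F ≡ relabelF g F
relabelF-ext e F = relabelF-cong F (tabulate (λ {x} _ → e x))

mutual
  relabelT-∘ : ∀ t → relabelT f (relabelT g t) ≡ relabelT (f ∘ g) t
  relabelT-∘ (node a ts) = cong (node _) (relabelF-∘ ts)

  relabelF-∘ : ∀ F → relabelF f (relabelF g F) ≡ relabelF (f ∘ g) F
  relabelF-∘ [] = refl
  relabelF-∘ (t ∷ ts) = cong₂ _∷_ (relabelT-∘ t) (relabelF-∘ ts)

mutual
  relabelT-id : ∀ t → relabelT id t ≡ t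
  relabelT-id (node a ts) = cong (node a) (relabelF-id ts)

  relabelF-id : ∀ F → relabelF id F ≡ F
  relabelF-id [] = refl
  relabelF-id (t ∷ ts) = cong₂ _∷_ (relabelT-id t) (relabelF-id ts)

relabelF-++ : ∀ f A B → relabelF f (A ++ B) ≡ relabelF f A ++ relabelF f B
relabelF-++ f [] B = refl
relabelF-++ f (t ∷ A) B = cong (relabelT f t ∷_) (relabelF-++ f A B)

relabelF-++⁻ : ∀ f D X → relabelF f D ≡ X ++ Y →
  ∃₂ λ X′ Y′ → D ≡ X′ ++ Y′ × X ≡ relabelF f X′ × Y ≡ relabelF f Y′
relabelF-++⁻ f D [] eq = [] , D , refl , refl , sym eq
relabelF-++⁻ f (t ∷ D) (_ ∷ X) eq with refl , eq′ ← ∷-injective eq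
  with X′ , Y′ , refl , refl , refl ← relabelF-++⁻ f D X eq′ = t ∷ X′ , Y′ , refl , refl , refl

mutual
  sizeT-relabel : ∀ f t → sizeT (relabelT f t) ≡ sizeT t
  sizeT-relabel f (node a ts) = cong suc (sizeF-relabel f ts)

  sizeF-relabel : ∀ f F → sizeF (relabelF f F) ≡ sizeF F
  sizeF-relabel f [] = refl
  sizeF-relabel f (t ∷ ts) = cong₂ _+_ (sizeT-relabel f t) (sizeF-relabel f ts)

sizeF-++ : ∀ A B → sizeF (A ++ B) ≡ sizeF A + sizeF B
sizeF-++ [] B = refl
sizeF-++ (t ∷ A) B = trans (cong (sizeT t +_) (sizeF-++ A B)) (sym (+-assoc (sizeT t) (sizeF A) (sizeF B)))

mutual
  labelsT-relabel : ∀ f t → labelsT (relabelT f t) ≡ map f (labelsT t)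
  labelsT-relabel f (node a ts) = cong (f a ∷_) (labelsF-relabel f ts)

  labelsF-relabel : ∀ f F → labelsF (relabelF f F) ≡ map f (labelsF F)
  labelsF-relabel f [] = refl
  labelsF-relabel f (t ∷ ts) =
    trans (cong₂ _++_ (labelsT-relabel f t) (labelsF-relabel f ts)) (sym (map-++ f (labelsT t) (labelsF ts)))

labelsF-++ : ∀ A B → labelsF (A ++ B) ≡ labelsF A ++ labelsF B
labelsF-++ [] B = refl
labelsF-++ (t ∷ A) B = trans (cong (labelsT t ++_) (labelsF-++ A B)) (sym (++-assoc (labelsT t) (labelsF A) (labelsF B)))

mutual
  length-labelsT : ∀ t → length (labelsT t) ≡ sizeT t
  length-labelsT (node a ts) = cong suc (length-labelsF ts)

  length-labelsF : ∀ F → length (labelsF F) ≡ sizeF F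
  length-labelsF [] = refl
  length-labelsF (t ∷ ts) = trans (length-++ (labelsT t)) (cong₂ _+_ (length-labelsT t) (length-labelsF ts))

All-labels-++⁺ : ∀ {P : ℕ → Set} A B → All P (labelsF A) → All P (labelsF B) → All P (labelsF (A ++ B))
All-labels-++⁺ {P} A B pA pB = subst (All P) (sym (labelsF-++ A B)) (++⁺ pA pB)

All-labels-relabel⁺ : ∀ {P : ℕ → Set} f F → All (P ∘ f) (labelsF F) → All P (labelsF (relabelF f F))
All-labels-relabel⁺ {P} f F p = subst (All P) (sym (labelsF-relabel f F)) (map⁺ p)

-- Standardisation

-- std F is definitionally relabelF (rank (labelsF F)) F.
rank : List ℕ → ℕ → ℕ
rank L a = suc (length (filter (_<? a) L))

rank-∷-< : ∀ {y} L → y < x → rank (y ∷ L) x ≡ suc (rank L x)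
rank-∷-< {x} L y<x = cong (suc ∘ length) (filter-accept (_<? x) {xs = L} y<x)

rank-∷-≮ : ∀ {y} L → ¬ y < x → rank (y ∷ L) x ≡ rank L x
rank-∷-≮ {x} L y≮x = cong (suc ∘ length) (filter-reject (_<? x) {xs = L} y≮x)

rank-all : ∀ {L} → All (_< x) L → rank L x ≡ suc (length L)
rank-all {x} h = cong (suc ∘ length) (filter-all (_<? x) h)

rank-shift : ∀ s L x → rank (map (s +_) L) (s + x) ≡ rank L x
rank-shift s [] x = refl
rank-shift s (y ∷ L) x with y <? x
... | yes y<x = begin
  rank (s + y ∷ map (s +_) L) (s + x) ≡⟨ rank-∷-< _ (+-monoʳ-< s y<x) ⟩
  suc (rank (map (s +_) L) (s + x))   ≡⟨ cong suc (rank-shift s L x) ⟩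
  suc (rank L x)                      ≡⟨ rank-∷-< L y<x ⟨
  rank (y ∷ L) x                      ∎
... | no y≮x = begin
  rank (s + y ∷ map (s +_) L) (s + x) ≡⟨ rank-∷-≮ _ (y≮x ∘ +-cancelˡ-< s y x) ⟩
  rank (map (s +_) L) (s + x)         ≡⟨ rank-shift s L x ⟩
  rank L x                            ≡⟨ rank-∷-≮ L y≮x ⟨
  rank (y ∷ L) x                      ∎

rank-++-ignore : ∀ L {M} → All (λ y → ¬ y < x) M → rank (L ++ M) x ≡ rank L x
rank-++-ignore {x} L {M} h = cong (suc ∘ length) (begin
  filter (_<? x) (L ++ M)              ≡⟨ filter-++ (_<? x) L M ⟩
  filter (_<? x) L ++ filter (_<? x) M ≡⟨ cong (filter (_<? x) L ++_) (filter-none (_<? x) h) ⟩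
  filter (_<? x) L ++ []               ≡⟨ ++-identityʳ _ ⟩
  filter (_<? x) L                     ∎)

rank-++-count : ∀ L M → All (_< x) L → rank (L ++ M) x ≡ length L + rank M x
rank-++-count {x} L M h = begin
  suc (length (filter (_<? x) (L ++ M)))              ≡⟨ cong (suc ∘ length) (filter-++ (_<? x) L M) ⟩
  suc (length (filter (_<? x) L ++ filter (_<? x) M))
    ≡⟨ cong (λ L′ → suc (length (L′ ++ filter (_<? x) M))) (filter-all (_<? x) h) ⟩
  suc (length (L ++ filter (_<? x) M))                ≡⟨ cong suc (length-++ L) ⟩
  suc (length L + length (filter (_<? x) M))          ≡⟨ +-suc (length L) _ ⟨
  length L + rank M x                                 ∎

std-shift : ∀ s F → std (relabelF (s +_) F) ≡ std F
std-shift s F = begin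
  relabelF (rank (labelsF (relabelF (s +_) F))) (relabelF (s +_) F)
    ≡⟨ cong (λ L → relabelF (rank L) (relabelF (s +_) F)) (labelsF-relabel (s +_) F) ⟩
  relabelF (rank (map (s +_) (labelsF F))) (relabelF (s +_) F)
    ≡⟨ relabelF-∘ F ⟩
  relabelF (rank (map (s +_) (labelsF F)) ∘ (s +_)) F
    ≡⟨ relabelF-ext (rank-shift s (labelsF F)) F ⟩
  std F ∎

std-++ : ∀ s A B → All (_≤ s) (labelsF A) → All (s <_) (labelsF B) →
  std (A ++ B) ≡ std A ++ relabelF (sizeF A +_) (std B)
std-++ s A B hA hB = begin
  relabelF (rank (labelsF (A ++ B))) (A ++ B)
    ≡⟨ cong (λ L → relabelF (rank L) (A ++ B)) (labelsF-++ A B) ⟩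
  relabelF (rank (LA ++ LB)) (A ++ B)
    ≡⟨ relabelF-++ _ A B ⟩
  relabelF (rank (LA ++ LB)) A ++ relabelF (rank (LA ++ LB)) B
    ≡⟨ cong₂ _++_ onA onB ⟩
  std A ++ relabelF (sizeF A +_) (std B) ∎
  where
  LA = labelsF A
  LB = labelsF B
  onA : relabelF (rank (LA ++ LB)) A ≡ std A
  onA = relabelF-cong A (All-map (λ x≤s → rank-++-ignore LA (All-map (λ s<y → <-asym (≤-<-trans x≤s s<y)) hB)) hA)
  onB : relabelF (rank (LA ++ LB)) B ≡ relabelF (sizeF A +_) (std B)
  onB = trans (relabelF-cong B (All-map (λ s<y → trans (rank-++-count LA LB (All-map (λ x≤s → ≤-<-trans x≤s s<y) hA))
                                                   (cong (_+ rank LB _) (length-labelsF A)))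
                                        hB))
              (sym (relabelF-∘ B))


std-·-shift : ∀ s A B → All (_≤ s) (labelsF A) → All (1 ≤_) (labelsF B) →
  std (A ++ relabelF (s +_) B) ≡ std A · std B
std-·-shift s A B hA hB = begin
  std (A ++ relabelF (s +_) B)
    ≡⟨ std-++ s A _ hA (All-labels-relabel⁺ (s +_) B (All-map (m<m+n s) hB)) ⟩
  std A ++ relabelF (sizeF A +_) (std (relabelF (s +_) B))
    ≡⟨ cong₂ (λ n B′ → std A ++ relabelF (n +_) B′) (sym (sizeF-relabel (rank (labelsF A)) A)) (std-shift s B) ⟩
  std A · std B ∎

std-node-max : ∀ k X → All (_< k) (labelsF X) → std (node k X ∷ []) ≡ node (suc (sizeF X)) (std X) ∷ []
std-node-max k X h rewrite ++-identityʳ (labelsF X) = cong [_] (cong₂ node root children)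
  where
  root : rank (k ∷ labelsF X) k ≡ suc (sizeF X)
  root = begin
    rank (k ∷ labelsF X) k    ≡⟨ rank-∷-≮ (labelsF X) (<-irrefl refl) ⟩
    rank (labelsF X) k        ≡⟨ rank-all h ⟩
    suc (length (labelsF X))  ≡⟨ cong suc (length-labelsF X) ⟩
    suc (sizeF X)             ∎
  children : relabelF (rank (k ∷ labelsF X)) X ≡ std X
  children = relabelF-cong X (All-map (λ x<k → rank-∷-≮ (labelsF X) (<-asym x<k)) h)

std-node-min : ∀ a X → All (a <_) (labelsF X) → std (node a X ∷ []) ≡ node 1 (relabelF suc (std X)) ∷ []
std-node-min a X h rewrite ++-identityʳ (labelsF X) = cong [_] (cong₂ node root children)
  where
  root : rank (a ∷ labelsF X) a ≡ 1
  root = trans (rank-∷-≮ (labelsF X) (<-irrefl refl))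
               (cong (suc ∘ length) (filter-none (_<? a) (All-map <-asym h)))
  children : relabelF (rank (a ∷ labelsF X)) X ≡ relabelF suc (std X)
  children = trans (relabelF-cong X (All-map (rank-∷-< (labelsF X)) h)) (sym (relabelF-∘ X))

-- Products

·-identityˡ : ∀ F → 𝟙 · F ≡ F
·-identityˡ = relabelF-id

·-identityʳ : ∀ F → F · 𝟙 ≡ F
·-identityʳ = ++-identityʳ

sizeF-· : ∀ A B → sizeF (A · B) ≡ sizeF A + sizeF B
sizeF-· A B = trans (sizeF-++ A _) (cong (sizeF A +_) (sizeF-relabel _ B))

·-assoc : ∀ A B C → (A · B) · C ≡ A · (B · C)
·-assoc A B C = begin
  (A ++ relabelF (sizeF A +_) B) ++ relabelF (sizeF (A · B) +_) C
    ≡⟨ ++-assoc A _ _ ⟩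
  A ++ (relabelF (sizeF A +_) B ++ relabelF (sizeF (A · B) +_) C)
    ≡⟨ cong (λ C′ → A ++ (relabelF (sizeF A +_) B ++ C′)) shiftC ⟩
  A ++ (relabelF (sizeF A +_) B ++ relabelF (sizeF A +_) (relabelF (sizeF B +_) C))
    ≡⟨ cong (A ++_) (relabelF-++ (sizeF A +_) B _) ⟨
  A · (B · C) ∎
  where
  shiftC : relabelF (sizeF (A · B) +_) C ≡ relabelF (sizeF A +_) (relabelF (sizeF B +_) C)
  shiftC = trans (relabelF-ext (λ x → trans (cong (_+ x) (sizeF-· A B)) (+-assoc (sizeF A) (sizeF B) x)) C)
                 (sym (relabelF-∘ C))

-- Mono is Prod G¹ by definition.
Prod : (Forest → Set) → Forest → Set
Prod P F = ∃ λ Fs → All P Fs × F ≡ foldr _·_ 𝟙 Fs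

Prod-[] : Prod P 𝟙
Prod-[] = [] , [] , refl

Prod-[_] : P F → Prod P F
Prod-[_] {F = F} p = F ∷ [] , p ∷ [] , sym (·-identityʳ F)

foldr-· : ∀ Fs B → foldr _·_ 𝟙 Fs · B ≡ foldr _·_ B Fs
foldr-· [] B = ·-identityˡ B
foldr-· (F ∷ Fs) B = trans (·-assoc F _ B) (cong (F ·_) (foldr-· Fs B))

Prod-· : Prod P A → Prod P B → Prod P (A · B)
Prod-· (Fs , ps , refl) (Gs , qs , refl) =
  Fs ++ Gs , ++⁺ ps qs , trans (foldr-· Fs _) (sym (foldr-++ _·_ 𝟙 Fs Gs))

Prod-map : (∀ {F} → P F → Q F) → Prod P F → Prod Q F
Prod-map h (Fs , ps , eq) = Fs , All-map h ps , eq

·-foldr-closed : (∀ {X M} → P X → Q M → P (X · M)) → ∀ {Ms} → P X → All Q Ms → P (X · foldr _·_ 𝟙 Ms)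
·-foldr-closed {P} {X = X} step pX [] = subst P (sym (·-identityʳ X)) pX
·-foldr-closed {P} {Q} {X} step pX (q ∷ qs) = subst P (·-assoc X _ _) (·-foldr-closed {P} {Q} step (step pX q) qs)

WellLabelled : Forest → Set
WellLabelled F = All (λ x → 1 ≤ x × x ≤ sizeF F) (labelsF F)

WellLabelled-· : WellLabelled A → WellLabelled B → WellLabelled (A · B)
WellLabelled-· {A} {B} wA wB = subst (λ n → All (λ x → 1 ≤ x × x ≤ n) (labelsF (A · B))) (sym (sizeF-· A B))
  (All-labels-++⁺ A _ (All-map (λ (p , q) → p , ≤-trans q (m≤m+n _ _)) wA)
     (All-labels-relabel⁺ (sizeF A +_) B (All-map (λ (p , q) → ≤-trans p (m≤n+m _ _) , +-monoʳ-≤ (sizeF A) q) wB)))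

WellLabelled-singleton : ∀ t → All (λ x → 1 ≤ x × x ≤ sizeT t) (labelsT t) → WellLabelled (t ∷ [])
WellLabelled-singleton t h = ++⁺ (All-map (λ (p , q) → p , ≤-trans q (m≤m+n (sizeT t) 0)) h) []

Canonical : Forest → Set
Canonical F = WellLabelled F × std F ≡ F

Canonical-· : Canonical A → Canonical B → Canonical (A · B)
Canonical-· {A} {B} (wA , sA) (wB , sB) = WellLabelled-· {A} {B} wA wB , (begin
  std (A ++ relabelF (sizeF A +_) B) ≡⟨ std-·-shift (sizeF A) A B (All-map proj₂ wA) (All-map proj₁ wB) ⟩
  std A · std B                      ≡⟨ cong₂ _·_ sA sB ⟩
  A · B                              ∎)

Prod-std-singleton : Canonical F → P F → Prod P (std F)
Prod-std-singleton {P = P} (_ , sF) p = subst (Prod P) (sym sF) Prod-[ p ]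

Canonical-foldr : ∀ {Fs} → All Canonical Fs → Canonical (foldr _·_ 𝟙 Fs)
Canonical-foldr [] = [] , refl
Canonical-foldr (c ∷ cs) = Canonical-· c (Canonical-foldr cs)

plusRoot : Forest → Forest
plusRoot M = node 1 (relabelF suc M) ∷ []

minusRoot : Forest → Forest
minusRoot D = node (suc (sizeF D)) D ∷ []

std-plusRoot : ∀ X → All (1 ≤_) (labelsF X) → std (plusRoot X) ≡ plusRoot (std X)
std-plusRoot X h = trans (std-node-min 1 (relabelF suc X) (All-labels-relabel⁺ suc X (All-map s≤s h)))
                         (cong (λ X′ → node 1 (relabelF suc X′) ∷ []) (std-shift 1 X))

std-minusRoot : ∀ n X → All (_≤ n) (labelsF X) → std (node (suc n) X ∷ []) ≡ minusRoot (std X)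
std-minusRoot n X h = trans (std-node-max (suc n) X (All-map s≤s h))
                            (cong (λ m → node (suc m) (std X) ∷ []) (sym (sizeF-relabel (rank (labelsF X)) X)))

Canonical-plusRoot : Canonical M → Canonical (plusRoot M)
Canonical-plusRoot {M} (wM , sM) =
  WellLabelled-singleton (node 1 (relabelF suc M)) ((≤-refl , s≤s z≤n) ∷ All-labels-relabel⁺ suc M
    (All-map (λ (_ , q) → s≤s z≤n , s≤s (subst (_ ≤_) (sym (sizeF-relabel suc M)) q)) wM)) ,
  trans (std-plusRoot M (All-map proj₁ wM)) (cong plusRoot sM)

Canonical-minusRoot : Canonical D → Canonical (minusRoot D)
Canonical-minusRoot {D} (wD , sD) =
  WellLabelled-singleton (node (suc (sizeF D)) D)
    ((s≤s z≤n , ≤-refl) ∷ All-map (λ (p , q) → p , ≤-trans q (n≤1+n _)) wD) ,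
  trans (std-minusRoot (sizeF D) D (All-map proj₂ wD)) (cong minusRoot sD)

-- Cuts

-- CutF F l r: (l , r) is (Lea_v F , Roo_v F), unstandardised, for an admissible cut v.
mutual
  data CutT : Tree → Forest → Forest → Set where
    croot  : CutT t (t ∷ []) []
    cbelow : ∀ {a ts l r} → CutF ts l r → CutT (node a ts) l (node a r ∷ [])

  data CutF : Forest → Forest → Forest → Set where
    cnil  : CutF [] [] []
    ccons : ∀ {t ts l₁ r₁ l₂ r₂} → CutT t l₁ r₁ → CutF ts l₂ r₂ →
            CutF (t ∷ ts) (l₁ ++ l₂) (r₁ ++ r₂)

mutual
  cutsT-sound : ∀ t {p} → p ∈ cutsT t → CutT t (proj₁ p) (proj₂ p)
  cutsT-sound (node a ts) (here refl) = croot
  cutsT-sound (node a ts) (there p∈) with _ , q∈ , refl ← ∈-map⁻ _ p∈ = cbelow (cutsF-sound ts q∈)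

  cutsF-sound : ∀ F {p} → p ∈ cutsF F → CutF F (proj₁ p) (proj₂ p)
  cutsF-sound [] (here refl) = cnil
  cutsF-sound (t ∷ ts) p∈ with _ , q₁∈ , p∈′ ← find (∈-concatMap⁻ _ {xs = cutsT t} p∈)
                          with _ , q₂∈ , refl ← ∈-map⁻ _ p∈′ =
    ccons (cutsT-sound t q₁∈) (cutsF-sound ts q₂∈)

cut-singleton⁻ : CutF (t ∷ []) l r → CutT t l r
cut-singleton⁻ (ccons {l₁ = l₁} {r₁} c cnil) rewrite ++-identityʳ l₁ | ++-identityʳ r₁ = c

data Relabelled {I : Set} (Cut : I → Forest → Forest → Set) (f : ℕ → ℕ) (i : I) : Forest → Forest → Set where
  relabelled : Cut i l r → Relabelled Cut f i (relabelF f l) (relabelF f r)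

mutual
  cutT-relabel⁻ : ∀ f t → CutT (relabelT f t) l r → Relabelled CutT f t l r
  cutT-relabel⁻ f (node a ts) croot = relabelled croot
  cutT-relabel⁻ f (node a ts) (cbelow c) with relabelled c′ ← cutF-relabel⁻ f ts c = relabelled (cbelow c′)

  cutF-relabel⁻ : ∀ f F → CutF (relabelF f F) l r → Relabelled CutF f F l r
  cutF-relabel⁻ f [] cnil = relabelled cnil
  cutF-relabel⁻ f (t ∷ F) (ccons c₁ c₂)
    with relabelled {l₁} {r₁} c₁′ ← cutT-relabel⁻ f t c₁
       | relabelled {l₂} {r₂} c₂′ ← cutF-relabel⁻ f F c₂ =
    subst₂ (Relabelled CutF f (t ∷ F)) (relabelF-++ f l₁ l₂) (relabelF-++ f r₁ r₂)
      (relabelled (ccons c₁′ c₂′))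

data Split (A B : Forest) : Forest → Forest → Set where
  split : ∀ {l₁ r₁ l₂ r₂} → CutF A l₁ r₁ → CutF B l₂ r₂ → Split A B (l₁ ++ l₂) (r₁ ++ r₂)

cut-++⁻ : ∀ A → CutF (A ++ B) l r → Split A B l r
cut-++⁻ [] c = split cnil c
cut-++⁻ {B} (t ∷ A) (ccons {l₁ = l₀} {r₀} c₀ c) with split {l₁} {r₁} {l₂} {r₂} c₁ c₂ ← cut-++⁻ A c =
  subst₂ (Split (t ∷ A) B) (++-assoc l₀ l₁ l₂) (++-assoc r₀ r₁ r₂) (split (ccons c₀ c₁) c₂)

data CutOfProduct (A B : Forest) : Forest → Forest → Set where
  cutOf· : ∀ {l₁ r₁ l₂ r₂} → CutF A l₁ r₁ → CutF B l₂ r₂ →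
    CutOfProduct A B (l₁ ++ relabelF (sizeF A +_) l₂) (r₁ ++ relabelF (sizeF A +_) r₂)

cut-·⁻ : ∀ A B → CutF (A · B) l r → CutOfProduct A B l r
cut-·⁻ A B c with split c₁ c₂ ← cut-++⁻ A c
             with relabelled c₂′ ← cutF-relabel⁻ (sizeF A +_) B c₂ = cutOf· c₁ c₂′

mutual
  cutT-labels : {R : ℕ → Set} → CutT t l r → All R (labelsT t) → All R (labelsF l) × All R (labelsF r)
  cutT-labels croot h = ++⁺ h [] , []
  cutT-labels (cbelow c) (pa ∷ h) with hl , hr ← cutF-labels c h = hl , ++⁺ (pa ∷ hr) []

  cutF-labels : {R : ℕ → Set} → CutF F l r → All R (labelsF F) → All R (labelsF l) × All R (labelsF r)
  cutF-labels cnil _ = [] , []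
  cutF-labels (ccons {t} {_} {l₁} {r₁} {l₂} {r₂} c₁ c₂) h
    with hl₁ , hr₁ ← cutT-labels c₁ (++⁻ˡ (labelsT t) h)
       | hl₂ , hr₂ ← cutF-labels c₂ (++⁻ʳ (labelsT t) h) =
    All-labels-++⁺ l₁ l₂ hl₁ hl₂ , All-labels-++⁺ r₁ r₂ hr₁ hr₂

CutClosed : (Forest → Set) → (Forest → Set) → Forest → Set
CutClosed P Q F = ∀ {l r} → CutF F l r → Prod P (std l) × Prod Q (std r)

std-cut-· : WellLabelled A → WellLabelled B → CutF A l r → CutF B X Y →
  std (l ++ relabelF (sizeF A +_) X) ≡ std l · std X × std (r ++ relabelF (sizeF A +_) Y) ≡ std r · std Y
std-cut-· {A} {l = l} {r} {X = X} {Y} wA wB cA cB with hl , hr ← cutF-labels cA wA | hX , hY ← cutF-labels cB wB =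
  std-·-shift (sizeF A) l X (All-map proj₂ hl) (All-map proj₁ hX) ,
  std-·-shift (sizeF A) r Y (All-map proj₂ hr) (All-map proj₁ hY)

CutClosed-· : WellLabelled A → WellLabelled B → CutClosed P Q A → CutClosed P Q B → CutClosed P Q (A · B)
CutClosed-· {A} {B} {P} {Q} wA wB hA hB c with cutOf· c₁ c₂ ← cut-·⁻ A B c
                                          with el , er ← std-cut-· wA wB c₁ c₂ =
  subst (Prod P) (sym el) (Prod-· (proj₁ (hA c₁)) (proj₁ (hB c₂))) ,
  subst (Prod Q) (sym er) (Prod-· (proj₂ (hA c₁)) (proj₂ (hB c₂)))

CutClosed-foldr : ∀ {Fs} → All Canonical Fs → All (CutClosed P Q) Fs → CutClosed P Q (foldr _·_ 𝟙 Fs)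
CutClosed-foldr [] [] cnil = Prod-[] , Prod-[]
CutClosed-foldr (w ∷ ws) (h ∷ hs) = CutClosed-· (proj₁ w) (proj₁ (Canonical-foldr ws)) h (CutClosed-foldr ws hs)

CutClosed-map : (∀ {F} → Q F → Q′ F) → CutClosed P Q F → CutClosed P Q′ F
CutClosed-map h cc c = proj₁ (cc c) , Prod-map h (proj₂ (cc c))

-- Plus trees and minus trees

mutual
  data PlusTree : Forest → Set where
    plusTree : ∀ {M} → Prod MinusTree M → PlusTree (plusRoot M)

  data MinusTree : Forest → Set where
    minusTree : ∀ {D} → Prod PlusTree D → MinusTree (minusRoot D)

module PlusMinusInduction {Qp Qm : Forest → Set}
  (plus-step  : ∀ {Ms} → All MinusTree Ms → All Qm Ms → Qp (plusRoot (foldr _·_ 𝟙 Ms)))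
  (minus-step : ∀ {Ds} → All PlusTree Ds → All Qp Ds → Qm (minusRoot (foldr _·_ 𝟙 Ds)))
  where
  mutual
    plusTree-ind : PlusTree F → Qp F
    plusTree-ind (plusTree (_ , ms , refl)) = plus-step ms (minusTrees-ind ms)

    minusTree-ind : MinusTree F → Qm F
    minusTree-ind (minusTree (_ , ps , refl)) = minus-step ps (plusTrees-ind ps)

    plusTrees-ind : ∀ {Fs} → All PlusTree Fs → All Qp Fs
    plusTrees-ind [] = []
    plusTrees-ind (p ∷ ps) = plusTree-ind p ∷ plusTrees-ind ps

    minusTrees-ind : ∀ {Fs} → All MinusTree Fs → All Qm Fs
    minusTrees-ind [] = []
    minusTrees-ind (m ∷ ms) = minusTree-ind m ∷ minusTrees-ind ms

module CanonicalInduction = PlusMinusInduction {Canonical} {Canonical}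
  (λ _ cs → Canonical-plusRoot (Canonical-foldr cs)) (λ _ cs → Canonical-minusRoot (Canonical-foldr cs))

PlusTrees-canonical : ∀ {Fs} → All PlusTree Fs → All Canonical Fs
PlusTrees-canonical = CanonicalInduction.plusTrees-ind

MinusTrees-canonical : ∀ {Fs} → All MinusTree Fs → All Canonical Fs
MinusTrees-canonical = CanonicalInduction.minusTrees-ind

-- Derivations

-- The forest built by InG.addPlusAttach.
attach : Forest → ℕ → Forest → Forest → ℕ → Forest
attach ts₁ a cs ts₂ n = ts₁ ++ node a (cs ∷ʳ node n ts₂) ∷ []

relabelF-attach : ∀ f ts₁ a cs ts₂ n →
  relabelF f (attach ts₁ a cs ts₂ n) ≡ attach (relabelF f ts₁) (f a) (relabelF f cs) (relabelF f ts₂) (f n)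
relabelF-attach f ts₁ a cs ts₂ n =
  trans (relabelF-++ f ts₁ _) (cong (λ cs′ → relabelF f ts₁ ++ node (f a) cs′ ∷ []) (relabelF-++ f cs _))

sizeF-attach : ∀ ts₁ a cs ts₂ n → sizeF (attach ts₁ a cs ts₂ n) ≡ suc (sizeF (ts₁ ++ node a cs ∷ ts₂))
sizeF-attach ts₁ a cs ts₂ n
  rewrite sizeF-++ ts₁ (node a (cs ∷ʳ node n ts₂) ∷ [])
        | sizeF-++ cs (node n ts₂ ∷ [])
        | sizeF-++ ts₁ (node a cs ∷ ts₂) =
  arith (sizeF ts₁) (sizeF cs) (sizeF ts₂)
  where
  arith : ∀ x y z → x + (suc (y + (suc z + 0)) + 0) ≡ suc (x + (suc y + z))
  arith = solve-∀

length-∷ʳ : ∀ {A : Set} (xs : List A) {x} → length (xs ∷ʳ x) ≡ suc (length xs)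
length-∷ʳ xs = trans (length-++ xs) (+-comm _ 1)

InG-size : InG w F → sizeF F ≡ length w
InG-size (base _) = refl
InG-size (addMinus {w} d) = trans (+-identityʳ _) (trans (cong suc (InG-size d)) (sym (length-∷ʳ w)))
InG-size (addPlusRight {w} {F} d) =
  trans (sizeF-++ F _) (trans (+-comm _ 1) (trans (cong suc (InG-size d)) (sym (length-∷ʳ w))))
InG-size (addPlusAttach {w} ts₁ a cs ts₂ d) =
  trans (sizeF-attach ts₁ a cs ts₂ _) (trans (cong suc (InG-size d)) (sym (length-∷ʳ w)))

length-++-suc : ∀ (v w : List Sign) → suc (length (v ++ w)) ≡ length v + suc (length w)
length-++-suc v w = trans (cong suc (length-++ v)) (sym (+-suc (length v) (length w)))

InG-replay : InG v X → InG w Y → All (_≡ plus) w → InG (v ++ w) (X ++ relabelF (length v +_) Y)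
InG-replay {v} {X} dX (base plus) _ =
  subst (λ n → InG (v ++ plus ∷ []) (X ++ node n [] ∷ [])) (+-comm 1 (length v)) (addPlusRight dX)
InG-replay dX (base minus) (() ∷ [])
InG-replay dX (addMinus {w} _) aw with () ∷ [] ← ++⁻ʳ w aw
InG-replay {v} {X} dX (addPlusRight {w} {Y} dY) aw =
  subst₂ InG (++-assoc v w (plus ∷ [])) grown (addPlusRight (InG-replay dX dY (++⁻ˡ w aw)))
  where
  shift : ℕ → ℕ
  shift = length v +_
  grown : (X ++ relabelF shift Y) ++ node (suc (length (v ++ w))) [] ∷ [] ≡
          X ++ relabelF shift (Y ∷ʳ node (suc (length w)) [])
  grown = trans (++-assoc X _ _) (cong (X ++_) (trans (cong (λ n → relabelF shift Y ++ node n [] ∷ []) (length-++-suc v w))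
                                                      (sym (relabelF-++ shift Y _))))
InG-replay {v} {X} dX (addPlusAttach {w} ts₁ a cs ts₂ dY) aw =
  subst₂ InG (++-assoc v w (plus ∷ [])) grown
    (addPlusAttach (X ++ relabelF shift ts₁) (shift a) (relabelF shift cs) (relabelF shift ts₂)
      (subst (InG (v ++ w)) exposed (InG-replay dX dY (++⁻ˡ w aw))))
  where
  shift : ℕ → ℕ
  shift = length v +_
  exposed : X ++ relabelF shift (ts₁ ++ node a cs ∷ ts₂) ≡
            (X ++ relabelF shift ts₁) ++ node (shift a) (relabelF shift cs) ∷ relabelF shift ts₂
  exposed = trans (cong (X ++_) (relabelF-++ shift ts₁ _)) (sym (++-assoc X _ _))
  grown : attach (X ++ relabelF shift ts₁) (shift a) (relabelF shift cs) (relabelF shift ts₂) (suc (length (v ++ w))) ≡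
          X ++ relabelF shift (attach ts₁ a cs ts₂ (suc (length w)))
  grown = trans (++-assoc X _ _) (cong (X ++_) (trans (cong (attach _ _ _ _) (length-++-suc v w))
                                                      (sym (relabelF-attach shift ts₁ a cs ts₂ _))))

PlusDerivable : Forest → Set
PlusDerivable F = ∃ λ w → All (_≡ plus) w × InG w F

PlusDerivable-· : PlusDerivable A → PlusDerivable B → PlusDerivable (A · B)
PlusDerivable-· {A} {B} (v , av , dA) (w , aw , dB) =
  v ++ w , ++⁺ av aw , subst (λ n → InG (v ++ w) (A ++ relabelF (n +_) B)) (sym (InG-size dA)) (InG-replay dA dB aw)

PlusDerivable-·-foldr : ∀ {Ds} → PlusDerivable X → All PlusDerivable Ds → PlusDerivable (X · foldr _·_ 𝟙 Ds)
PlusDerivable-·-foldr = ·-foldr-closed {PlusDerivable} {PlusDerivable} PlusDerivable-·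

allEqual⇒replicate : ∀ {A : Set} {x : A} {xs} → All (_≡ x) xs → xs ≡ replicate (length xs) x
allEqual⇒replicate [] = refl
allEqual⇒replicate (refl ∷ h) = cong (_ ∷_) (allEqual⇒replicate h)

InG-last : InG w F → ∃₂ λ u e → w ≡ u ∷ʳ e
InG-last (base e) = [] , e , refl
InG-last (addMinus {w} _) = w , minus , refl
InG-last (addPlusRight {w} _) = w , plus , refl
InG-last (addPlusAttach {w} _ _ _ _ _) = w , plus , refl

PlusDerivable-G¹ : PlusDerivable F → G¹ F
PlusDerivable-G¹ (_ , aw , d) with u , _ , refl ← InG-last d with refl ∷ [] ← ++⁻ʳ u aw =
  length u , plus , subst (λ u′ → InG (u′ ∷ʳ plus) _) (allEqual⇒replicate (++⁻ˡ u aw)) d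

sizeF-plusRoot : ∀ M → sizeF (plusRoot M) ≡ suc (sizeF M)
sizeF-plusRoot M = trans (+-identityʳ _) (cong suc (sizeF-relabel suc M))

plusRoot-graft : ∀ M D →
  attach [] 1 (relabelF suc M) (relabelF (sizeF (plusRoot M) +_) D) (suc (sizeF (plusRoot M · D))) ≡
  plusRoot (M · minusRoot D)
plusRoot-graft M D =
  trans (cong₂ (λ n D′ → node 1 (relabelF suc M ++ node n D′ ∷ []) ∷ []) rootLabel children)
        (cong (λ C → node 1 C ∷ []) (sym (relabelF-++ suc M _)))
  where
  rootLabel : suc (sizeF (plusRoot M · D)) ≡ suc (sizeF M + suc (sizeF D))
  rootLabel = cong suc (trans (sizeF-· (plusRoot M) D) (trans (cong (_+ sizeF D) (sizeF-plusRoot M)) (sym (+-suc _ _))))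
  children : relabelF (sizeF (plusRoot M) +_) D ≡ relabelF suc (relabelF (sizeF M +_) D)
  children = trans (relabelF-ext (λ x → cong (_+ x) (sizeF-plusRoot M)) D) (sym (relabelF-∘ D))

•₁-PlusDerivable : PlusDerivable •₁
•₁-PlusDerivable = plus ∷ [] , refl ∷ [] , base plus

Graftable : Forest → Set
Graftable m = ∀ {X} → PlusDerivable (plusRoot X) → PlusDerivable (plusRoot (X · m))

plusRoot-PlusDerivable : ∀ {Ms} → All MinusTree Ms → All Graftable Ms → PlusDerivable (plusRoot (foldr _·_ 𝟙 Ms))
plusRoot-PlusDerivable _ gs =
  subst (PlusDerivable ∘ plusRoot) (·-identityˡ _)
    (·-foldr-closed {PlusDerivable ∘ plusRoot} {Graftable} (λ dX g → g dX) •₁-PlusDerivable gs)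

-- Replay the derivation of D to the right of plusRoot X; one + step then attaches the new,
-- largest vertex to the root 1 and makes the copy of D its children.
minusRoot-Graftable : ∀ {Ds} → All PlusTree Ds → All PlusDerivable Ds → Graftable (minusRoot (foldr _·_ 𝟙 Ds))
minusRoot-Graftable {Ds} _ ds {X} dX with w , aw , d ← PlusDerivable-·-foldr dX ds =
  w ∷ʳ plus , ++⁺ aw (refl ∷ []) ,
  subst (InG (w ∷ʳ plus))
    (trans (cong (λ n → attach [] 1 (relabelF suc X) _ (suc n)) (sym (InG-size d))) (plusRoot-graft X _))
    (addPlusAttach [] 1 (relabelF suc X) _ d)

module DerivableInduction = PlusMinusInduction plusRoot-PlusDerivable minusRoot-Graftable

PlusTree-derivable : PlusTree F → PlusDerivable F
PlusTree-derivable = DerivableInduction.plusTree-ind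

PlusTree-G¹ : PlusTree F → G¹ F
PlusTree-G¹ = PlusDerivable-G¹ ∘ PlusTree-derivable

MinusTree-G¹ : MinusTree F → G¹ F
MinusTree-G¹ (minusTree ([] , [] , refl)) = 0 , minus , base minus
MinusTree-G¹ (minusTree (_ ∷ _ , p ∷ ps , refl))
  with w , aw , d ← PlusDerivable-·-foldr (PlusTree-derivable p) (All-map PlusTree-derivable ps) =
  length w , minus ,
  subst₂ (λ u n → InG (u ∷ʳ minus) (node (suc n) _ ∷ [])) (allEqual⇒replicate aw) (sym (InG-size d)) (addMinus d)

-- Attaching the new vertex to the root of the i-th tree merges that tree and all trees to
-- its right into a single plus tree.
ProdPlus-attach : ∀ {Fs} → All PlusTree Fs →
  ∀ ts₁ {a cs ts₂} → foldr _·_ 𝟙 Fs ≡ ts₁ ++ node a cs ∷ ts₂ →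
  Prod PlusTree (attach ts₁ a cs ts₂ (suc (sizeF (foldr _·_ 𝟙 Fs))))
ProdPlus-attach [] [] ()
ProdPlus-attach [] (_ ∷ _) ()
ProdPlus-attach (plusTree {M} pm ∷ ps) [] refl =
  subst (Prod PlusTree) (sym (plusRoot-graft M _)) Prod-[ plusTree (Prod-· pm Prod-[ minusTree (_ , ps , refl) ]) ]
ProdPlus-attach {_ ∷ Fs} (plusTree {M} pm ∷ ps) (u ∷ ts₁) eq
  with refl , eq′ ← ∷-injective eq
  with X′ , node a′ cs′ ∷ B′ , rest≡ , refl , refl ← relabelF-++⁻ (sizeF (plusRoot M) +_) (foldr _·_ 𝟙 Fs) ts₁ eq′
  =
  subst (Prod PlusTree) (cong (u ∷_) shifted) (Prod-· Prod-[ plusTree pm ] (ProdPlus-attach ps X′ rest≡))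
  where
  shift : ℕ → ℕ
  shift = sizeF (plusRoot M) +_
  shifted : relabelF shift (attach X′ a′ cs′ B′ (suc (sizeF (foldr _·_ 𝟙 Fs)))) ≡
            attach (relabelF shift X′) (shift a′) (relabelF shift cs′) (relabelF shift B′)
                   (suc (sizeF (plusRoot M · foldr _·_ 𝟙 Fs)))
  shifted = trans (relabelF-attach shift X′ a′ cs′ B′ _)
                  (cong (attach _ _ _ _) (trans (+-suc (sizeF (plusRoot M)) _)
                                                (cong suc (sym (sizeF-· (plusRoot M) (foldr _·_ 𝟙 Fs))))))

allPlus-ProdPlus : InG w F → All (_≡ plus) w → Prod PlusTree F
allPlus-ProdPlus (base _) (refl ∷ []) = Prod-[ plusTree Prod-[] ]
allPlus-ProdPlus (addMinus {w} _) aw with () ∷ [] ← ++⁻ʳ w aw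
allPlus-ProdPlus (addPlusRight {w} {F} d) aw =
  subst (λ n → Prod PlusTree (F ++ node n [] ∷ [])) (trans (+-comm _ 1) (cong suc (InG-size d)))
    (Prod-· (allPlus-ProdPlus d (++⁻ˡ w aw)) Prod-[ plusTree Prod-[] ])
allPlus-ProdPlus (addPlusAttach {w} ts₁ a cs ts₂ d) aw with Fs , ps , eq ← allPlus-ProdPlus d (++⁻ˡ w aw) =
  subst (λ n → Prod PlusTree (attach ts₁ a cs ts₂ (suc n))) (trans (cong sizeF (sym eq)) (InG-size d))
    (ProdPlus-attach ps ts₁ (sym eq))

minusWord-MinusTree : InG w F → w ≡ v ∷ʳ minus → All (_≡ plus) v → MinusTree F
minusWord-MinusTree (base _) _ _ = minusTree Prod-[]
minusWord-MinusTree {v = v} (addMinus {w} {F} d) eq av with refl ← ∷ʳ-injectiveˡ w v eq =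
  subst MinusTree (cong (λ n → node (suc n) F ∷ []) (InG-size d)) (minusTree (allPlus-ProdPlus d av))
minusWord-MinusTree (addPlusRight {w} _) eq _ with () ← ∷ʳ-injectiveʳ w _ eq
minusWord-MinusTree (addPlusAttach {w} _ _ _ _ _) eq _ with () ← ∷ʳ-injectiveʳ w _ eq

G¹-classify : G¹ F → Prod PlusTree F ⊎ MinusTree F
G¹-classify (k , plus , d) = inj₁ (allPlus-ProdPlus d (++⁺ (replicate⁺ k refl) (refl ∷ [])))
G¹-classify (k , minus , d) = inj₂ (minusWord-MinusTree d refl (replicate⁺ k refl))

G¹-canonical : G¹ F → Canonical F
G¹-canonical g with G¹-classify g
... | inj₁ (_ , ps , refl) = Canonical-foldr (PlusTrees-canonical ps)
... | inj₂ (minusTree (_ , ps , refl)) = Canonical-minusRoot (Canonical-foldr (PlusTrees-canonical ps))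

-- Cuts of plus and minus trees

plusRoot-CutClosed : ∀ {Ms} → All MinusTree Ms → All (CutClosed G¹ MinusTree) Ms →
  CutClosed G¹ PlusTree (plusRoot (foldr _·_ 𝟙 Ms))
plusRoot-CutClosed {Ms} ms cms = cut
  where
  cMs : Canonical (foldr _·_ 𝟙 Ms)
  cMs = Canonical-foldr (MinusTrees-canonical ms)
  cut : CutClosed G¹ PlusTree (plusRoot (foldr _·_ 𝟙 Ms))
  cut c with cut-singleton⁻ c
  ... | croot = Prod-std-singleton (Canonical-plusRoot cMs) (PlusTree-G¹ (plusTree (Ms , ms , refl))) , Prod-[]
  ... | cbelow c′ with relabelled {l₀} {r₀} c₀ ← cutF-relabel⁻ suc _ c′
                  with gl , mr ← CutClosed-foldr (MinusTrees-canonical ms) cms c₀ =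
    subst (Prod G¹) (sym (std-shift 1 l₀)) gl ,
    subst (Prod PlusTree) (sym (std-plusRoot r₀ (All-map proj₁ (proj₂ (cutF-labels c₀ (proj₁ cMs))))))
      Prod-[ plusTree mr ]

minusRoot-CutClosed : ∀ {Ds} → All PlusTree Ds → All (CutClosed G¹ PlusTree) Ds →
  CutClosed G¹ MinusTree (minusRoot (foldr _·_ 𝟙 Ds))
minusRoot-CutClosed {Ds} ps cps = cut
  where
  cDs : Canonical (foldr _·_ 𝟙 Ds)
  cDs = Canonical-foldr (PlusTrees-canonical ps)
  cut : CutClosed G¹ MinusTree (minusRoot (foldr _·_ 𝟙 Ds))
  cut c with cut-singleton⁻ c
  ... | croot = Prod-std-singleton (Canonical-minusRoot cDs) (MinusTree-G¹ (minusTree (Ds , ps , refl))) , Prod-[]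
  ... | cbelow c′ with gl , pr ← CutClosed-foldr (PlusTrees-canonical ps) cps c′ =
    gl ,
    subst (Prod MinusTree) (sym (std-minusRoot _ _ (All-map proj₂ (proj₂ (cutF-labels c′ (proj₁ cDs))))))
      Prod-[ minusTree pr ]

module CutInduction = PlusMinusInduction plusRoot-CutClosed minusRoot-CutClosed

G¹-CutClosed : G¹ F → CutClosed G¹ G¹ F
G¹-CutClosed g with G¹-classify g
... | inj₁ (_ , ps , refl) =
  CutClosed-map PlusTree-G¹ (CutClosed-foldr (PlusTrees-canonical ps) (CutInduction.plusTrees-ind ps))
... | inj₂ m = CutClosed-map MinusTree-G¹ (CutInduction.minusTree-ind m)

Mono-CutClosed : Mono F → CutClosed G¹ G¹ F
Mono-CutClosed (_ , gs , refl) = CutClosed-foldr (All-map G¹-canonical gs) (All-map G¹-CutClosed gs)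

Δterms-Mono : ∀ {p} → Mono F → p ∈ Δterms F → Mono (proj₁ p) × Mono (proj₂ p)
Δterms-Mono m p∈ with _ , q∈ , refl ← ∈-map⁻ _ p∈ = Mono-CutClosed m (cutsF-sound _ q∈)

-- Linearity

module LinearAlgebra {c ℓ : Level} (K : CommutativeRing c ℓ) where
  open Linear K
  open CommutativeRing K
    using (Carrier; _≈_; _*_; 0#; 1#; *-congʳ; *-identityʳ; zeroˡ; zeroʳ; distribˡ; distribʳ)
    renaming ( _+_ to _⊕_; refl to ≈-refl; sym to ≈-sym; trans to ≈-trans; +-assoc to ⊕-assoc; +-comm to ⊕-comm
             ; +-identityˡ to ⊕-identityˡ; +-identityʳ to ⊕-identityʳ
             ; +-cong to ⊕-cong; +-congˡ to ⊕-congˡ; +-congʳ to ⊕-congʳ)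

  linExt : {X : Set} → (X → Carrier) → Lin X → Carrier
  linExt h [] = 0#
  linExt h ((k , x) ∷ a) = k * h x ⊕ linExt h a

  module _ {X : Set} (_≟_ : DecidableEquality X) where

    _≈ᶜ_ : Lin X → Lin X → Set ℓ
    a ≈ᶜ b = ∀ x → coeff _≟_ a x ≈ coeff _≟_ b x

    coeff-++ : ∀ a b x → coeff _≟_ (a ++ b) x ≈ coeff _≟_ a x ⊕ coeff _≟_ b x
    coeff-++ [] b x = ≈-sym (⊕-identityˡ _)
    coeff-++ ((k , y) ∷ a) b x with y ≟ x
    ... | yes _ = ≈-trans (⊕-congˡ (coeff-++ a b x)) (≈-sym (⊕-assoc _ _ _))
    ... | no _ = coeff-++ a b x

    remove : X → Lin X → Lin X
    remove x [] = []
    remove x ((k , y) ∷ a) with y ≟ x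
    ... | yes _ = remove x a
    ... | no _ = (k , y) ∷ remove x a

    coeff-remove-≡ : ∀ x a → coeff _≟_ (remove x a) x ≈ 0#
    coeff-remove-≡ x [] = ≈-refl
    coeff-remove-≡ x ((k , y) ∷ a) with y ≟ x
    ... | yes _ = coeff-remove-≡ x a
    ... | no y≢x with y ≟ x
    ...   | yes y≡x = ⊥-elim (y≢x y≡x)
    ...   | no _ = coeff-remove-≡ x a

    coeff-remove-≢ : ∀ x a {z} → ¬ z ≡ x → coeff _≟_ (remove x a) z ≈ coeff _≟_ a z
    coeff-remove-≢ x [] z≢x = ≈-refl
    coeff-remove-≢ x ((k , y) ∷ a) {z} z≢x with y ≟ x
    ... | yes refl with y ≟ z
    ...   | yes refl = ⊥-elim (z≢x refl)
    ...   | no _ = coeff-remove-≢ x a z≢x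
    coeff-remove-≢ x ((k , y) ∷ a) {z} z≢x | no _ with y ≟ z
    ...   | yes _ = ⊕-congˡ (coeff-remove-≢ x a z≢x)
    ...   | no _ = coeff-remove-≢ x a z≢x

    remove-cong : ∀ x {a b} → a ≈ᶜ b → remove x a ≈ᶜ remove x b
    remove-cong x {a} {b} e z with z ≟ x
    ... | yes refl = ≈-trans (coeff-remove-≡ x a) (≈-sym (coeff-remove-≡ x b))
    ... | no z≢x = ≈-trans (coeff-remove-≢ x a z≢x) (≈-trans (e z) (≈-sym (coeff-remove-≢ x b z≢x)))

    length-remove : ∀ x a → length (remove x a) ≤ length a
    length-remove x [] = z≤n
    length-remove x ((k , y) ∷ a) with y ≟ x
    ... | yes _ = m≤n⇒m≤1+n (length-remove x a)
    ... | no _ = s≤s (length-remove x a)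

    length-remove-head : ∀ x k a → length (remove x ((k , x) ∷ a)) ≤ length a
    length-remove-head x k a with x ≟ x
    ... | yes _ = length-remove x a
    ... | no x≢x = ⊥-elim (x≢x refl)

    linExt-remove : ∀ h x a → linExt h a ≈ coeff _≟_ a x * h x ⊕ linExt h (remove x a)
    linExt-remove h x [] = ≈-sym (≈-trans (⊕-identityʳ _) (zeroˡ _))
    linExt-remove h x ((k , y) ∷ a) with y ≟ x
    ... | yes refl = ≈-trans (⊕-congˡ (linExt-remove h x a))
                       (≈-trans (≈-sym (⊕-assoc _ _ _)) (⊕-congʳ (≈-sym (distribʳ (h x) k _))))
    ... | no _ = ≈-trans (⊕-congˡ (linExt-remove h x a))
                   (≈-trans (≈-sym (⊕-assoc _ _ _)) (≈-trans (⊕-congʳ (⊕-comm _ _)) (⊕-assoc _ _ _)))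

    -- Induction on the total length, removing one key from both sides at a time.
    linExt-cong : ∀ h {a b} → a ≈ᶜ b → linExt h a ≈ linExt h b
    linExt-cong h {a} {b} = bounded (length a + length b) a b ≤-refl
      where
      bounded : ∀ n a b → length a + length b ≤ n → a ≈ᶜ b → linExt h a ≈ linExt h b
      removing : ∀ n x a b → length (remove x a) + length (remove x b) ≤ n → a ≈ᶜ b → linExt h a ≈ linExt h b
      bounded _ [] [] _ _ = ≈-refl
      bounded (suc n) ((k , x) ∷ a) b (s≤s le) e =
        removing n x ((k , x) ∷ a) b (≤-trans (+-mono-≤ (length-remove-head x k a) (length-remove x b)) le) e
      bounded (suc n) [] ((k , x) ∷ b) (s≤s le) e =
        removing n x [] ((k , x) ∷ b) (≤-trans (length-remove-head x k b) le) e
      removing n x a b le e =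
        ≈-trans (linExt-remove h x a)
          (≈-trans (⊕-cong (*-congʳ (e x)) (bounded n (remove x a) (remove x b) le (remove-cong x {a} {b} e)))
                   (≈-sym (linExt-remove h x b)))

    _≈ᵗ_ : Carrier × X → Carrier × X → Set ℓ
    (k , x) ≈ᵗ (k′ , x′) = k ≈ k′ × x ≡ x′

    Pointwise-coeff : ∀ {a b} → Pointwise _≈ᵗ_ a b → a ≈ᶜ b
    Pointwise-coeff [] x = ≈-refl
    Pointwise-coeff {(_ , y) ∷ _} ((k≈k′ , refl) ∷ ps) x with y ≟ x
    ... | yes _ = ⊕-cong k≈k′ (Pointwise-coeff ps x)
    ... | no _ = Pointwise-coeff ps x

  multiplicity : Forest × Forest → Forest → Carrier
  multiplicity p F = coeff _≟FF_ (map (1# ,_) (Δterms F)) p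

  coeff-scale : ∀ k qs p → coeff _≟FF_ (map (k ,_) qs) p ≈ k * coeff _≟FF_ (map (1# ,_) qs) p
  coeff-scale k [] p = ≈-sym (zeroʳ k)
  coeff-scale k (q ∷ qs) p with q ≟FF p
  ... | yes _ = ≈-trans (⊕-cong (≈-sym (*-identityʳ k)) (coeff-scale k qs p)) (≈-sym (distribˡ k 1# _))
  ... | no _ = coeff-scale k qs p

  coeff-Δ : ∀ a p → coeff _≟FF_ (Δ a) p ≈ linExt (multiplicity p) a
  coeff-Δ [] p = ≈-refl
  coeff-Δ ((k , F) ∷ a) p =
    ≈-trans (coeff-++ _≟FF_ (map (k ,_) (Δterms F)) (Δ a) p) (⊕-cong (coeff-scale k (Δterms F) p) (coeff-Δ a p))

  Δ-cong : ∀ a b → a ≈H b → Δ a ≈H⊗H Δ b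
  Δ-cong a b e p =
    ≈-trans (coeff-Δ a p) (≈-trans (linExt-cong _≟F_ (multiplicity p) {a} {b} e) (≈-sym (coeff-Δ b p)))

  termTensor : Carrier → Forest × Forest → H × H
  termTensor k (l , r) = [ (k , l) ] , [ (1# , r) ]

  tensors : H → List (H × H)
  tensors [] = []
  tensors ((k , F) ∷ b) = map (termTensor k) (Δterms F) ++ tensors b

  tensorSum : List (H × H) → H⊗H
  tensorSum ps = concat (map (λ p → proj₁ p ⊗ proj₂ p) ps)

  tensorSum-++ : ∀ ps qs → tensorSum (ps ++ qs) ≡ tensorSum ps ++ tensorSum qs
  tensorSum-++ ps qs = trans (cong concat (map-++ _ ps qs)) (sym (concat-++ (map tensor ps) (map tensor qs)))
    where
    tensor : H × H → H⊗H
    tensor (a , b) = a ⊗ b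

  tensorSum-tensors : ∀ b → Pointwise (_≈ᵗ_ _≟FF_) (tensorSum (tensors b)) (Δ b)
  tensorSum-tensors [] = []
  tensorSum-tensors ((k , F) ∷ b) =
    subst (λ t → Pointwise (_≈ᵗ_ _≟FF_) t (Δ ((k , F) ∷ b)))
      (sym (tensorSum-++ (map (termTensor k) (Δterms F)) (tensors b)))
      (Pointwise-++⁺ (termwise (Δterms F)) (tensorSum-tensors b))
    where
    termwise : ∀ qs → Pointwise (_≈ᵗ_ _≟FF_) (tensorSum (map (termTensor k) qs)) (map (k ,_) qs)
    termwise [] = []
    termwise (q ∷ qs) = (*-identityʳ k , refl) ∷ termwise qs

  Δ≈tensorSum : ∀ b → Δ b ≈H⊗H tensorSum (tensors b)
  Δ≈tensorSum b p = ≈-sym (Pointwise-coeff _≟FF_ {tensorSum (tensors b)} {Δ b} (tensorSum-tensors b) p)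

  InB¹-singleton : ∀ k {F} → Mono F → InB¹ [ (k , F) ]
  InB¹-singleton k {F} m = [ (k , F) ] , m ∷ [] , λ _ → ≈-refl

  tensors-InB¹ : ∀ {b} → All (λ x → Mono (proj₂ x)) b →
    All (λ p → InB¹ (proj₁ p) × InB¹ (proj₂ p)) (tensors b)
  tensors-InB¹ [] = []
  tensors-InB¹ {(k , F) ∷ _} (m ∷ ms) = ++⁺ (map⁺ (tabulate termwise)) (tensors-InB¹ ms)
    where
    termwise : ∀ {q} → q ∈ Δterms F → InB¹ (proj₁ (termTensor k q)) × InB¹ (proj₂ (termTensor k q))
    termwise q∈ with ml , mr ← Δterms-Mono m q∈ = InB¹-singleton k ml , InB¹-singleton 1# mr

proposition1p9 : ∀ {c ℓ : Level} (K : CommutativeRing c ℓ) → Linear.IsField K →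
    (x : Linear.H K) → Linear.InB¹ K x → Linear.InB¹⊗B¹ K (Linear.Δ K x)
proposition1p9 K _ x (b , mb , x≈b) =
  tensors b , tensors-InB¹ mb , λ p → ≈-trans (Δ-cong x b x≈b p) (Δ≈tensorSum b p)
  where
  open LinearAlgebra K
  open CommutativeRing K using () renaming (trans to ≈-trans)
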